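{- If $H$ is a connected graph that has weak BEL gadgets, then $H$ has BEL gadgets.
   Context: All graphs are finite and simple; a copy of a graph means a (not necessarily induced) subgraph isomorphic to it. For graphs $F,H$, write $F\to H$ if every 2-coloring (red/blue) of the edges of $F$ contains a monochromatic copy of $H$, and $F\not\to H$ otherwise. A graph $H$ has weak BEL gadgets if for all edge-disjoint graphs $G_0,G_1$ on the same vertex set, each containing no copy of $H$, there is a graph $G$ containing an induced copy of $G_0\cup G_1$ such that there is a 2-coloring of the edges of $G$ without a monochromatic copy of $H$ in which $G_0$ is red and $G_1$ is blue, and in every 2-coloring of the edges of $G$ without a monochromatic copy of $H$ all edges of $G_0$ have the same color and all edges of $G_1$ have the same color. A graph $H$ has BEL gadgets if for every graph $G$ and every 2-coloring $\psi$ of the edges of $G$ without a monochromatic copy of $H$, there is a graph $F$ such that (1) $F\not\to H$, (2) $F$ contains $G$ as an induced subgraph, and (3) for every 2-coloring of the edges of $F$ without a monochromatic copy of $H$, its restriction to $G$ agrees with $\psi$ up to swapping the two colors. -}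

module Defs where

open import Data.Nat using (ℕ)
open import Data.Fin using (Fin)
open import Data.Bool using (Bool; true; false; not; _∨_)
open import Data.Product using (Σ; ∃; _×_; _,_)
open import Data.Sum using (_⊎_)
open import Relation.Nullary using (¬_)
open import Relation.Binary.PropositionalEquality using (_≡_; refl; cong₂)
open import Function.Definitions using (Injective)

record Graph (n : ℕ) : Set where
  field
    adj    : Fin n → Fin n → Bool
    sym    : ∀ u v → adj u v ≡ adj v u
    irrefl : ∀ u → adj u u ≡ false
open Graph public

Edge : ∀ {n} → Graph n → Fin n → Fin n → Set
Edge G u v = adj G u v ≡ true

_∪G_ : ∀ {n} → Graph n → Graph n → Graph n
adj (G₀ ∪G G₁) u v = adj G₀ u v ∨ adj G₁ u v
sym (G₀ ∪G G₁) u v = cong₂ _∨_ (sym G₀ u v) (sym G₁ u v)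
irrefl (G₀ ∪G G₁) u rewrite irrefl G₀ u | irrefl G₁ u = refl

EdgeDisjoint : ∀ {n} → Graph n → Graph n → Set
EdgeDisjoint G₀ G₁ = ∀ u v → Edge G₀ u v → ¬ Edge G₁ u v

data Reach {n} (G : Graph n) : Fin n → Fin n → Set where
  here : ∀ {u} → Reach G u u
  step : ∀ {u v w} → Edge G u v → Reach G v w → Reach G u w

Connected : ∀ {n} → Graph n → Set
Connected G = ∀ u v → Reach G u v

-- Colours: true = red, false = blue.  A 2-colouring of the edges of a graph
-- on Fin n is a symmetric colour assignment to pairs (values on non-edges
-- are irrelevant).
record Coloring (n : ℕ) : Set where
  field
    col    : Fin n → Fin n → Bool
    colSym : ∀ u v → col u v ≡ col v u
open Coloring public

Embeds : ∀ {h n} → Graph h → Graph n → (Fin h → Fin n) → Set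
Embeds H G f = Injective _≡_ _≡_ f × (∀ u v → Edge H u v → Edge G (f u) (f v))

Copy : ∀ {h n} → Graph h → Graph n → Set
Copy H G = ∃ λ f → Embeds H G f

HFree : ∀ {h n} → Graph h → Graph n → Set
HFree H G = ¬ Copy H G

MonoCopy : ∀ {h n} → Graph h → Graph n → Coloring n → Set
MonoCopy H G c = Σ Bool λ b → ∃ λ f → Embeds H G f ×
  (∀ u v → Edge H u v → col c (f u) (f v) ≡ b)

Good : ∀ {h n} → Graph h → Graph n → Coloring n → Set
Good H G c = ¬ MonoCopy H G c

NotArrows : ∀ {h n} → Graph n → Graph h → Set
NotArrows F H = ∃ λ c → Good H F c

InducedEmb : ∀ {n m} → Graph n → Graph m → (Fin n → Fin m) → Set
InducedEmb G F f = Injective _≡_ _≡_ f × (∀ u v → adj F (f u) (f v) ≡ adj G u v)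

WeakBEL : ∀ {h} → Graph h → Set
WeakBEL H = ∀ n (G₀ G₁ : Graph n) → EdgeDisjoint G₀ G₁ → HFree H G₀ → HFree H G₁ →
  Σ ℕ λ m → Σ (Graph m) λ G → ∃ λ (f : Fin n → Fin m) →
    InducedEmb (G₀ ∪G G₁) G f ×
    (∃ λ c → Good H G c
       × (∀ u v → Edge G₀ u v → col c (f u) (f v) ≡ true)
       × (∀ u v → Edge G₁ u v → col c (f u) (f v) ≡ false)) ×
    (∀ c → Good H G c →
       (∀ u v u' v' → Edge G₀ u v → Edge G₀ u' v' → col c (f u) (f v) ≡ col c (f u') (f v'))
     × (∀ u v u' v' → Edge G₁ u v → Edge G₁ u' v' → col c (f u) (f v) ≡ col c (f u') (f v')))

BEL : ∀ {h} → Graph h → Set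
BEL H = ∀ n (G : Graph n) (ψ : Coloring n) → Good H G ψ →
  Σ ℕ λ m → Σ (Graph m) λ F → NotArrows F H × (∃ λ (f : Fin n → Fin m) →
    InducedEmb G F f ×
    (∀ χ → Good H F χ →
       (∀ u v → Edge G u v → col χ (f u) (f v) ≡ col ψ u v)
     ⊎ (∀ u v → Edge G u v → col χ (f u) (f v) ≡ not (col ψ u v))))

-- Let H be connected.  If H has at most two vertices, a good colouring
-- only exists on edgeless graphs, and G itself is a BEL gadget.  Otherwise
-- connectivity gives two distinct edges ab and cd of H.  Given G with a good
-- colouring ψ, put
--     G₀ = (red edges of G) ⊕ (H minus ab),   G₁ = (blue edges of G) ⊕ ab,
-- where ⊕ is disjoint union.  Both are H-free: the colour classes because ψ
-- is good, H − ab because an injective map H → H − ab would force (through a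
-- pigeonhole argument on iterates) ab to be an edge of H − ab, the single
-- edge because H has a second edge, and disjoint unions because H is
-- connected.  A weak BEL gadget for (G₀, G₁) colours all of G₀ with one colour
-- β and all of G₁ with one colour γ; γ ≠ β since otherwise the copy of
-- H = (H − ab) ∪ ab would be monochromatic.  Hence on G the gadget's colouring
-- is ψ or its swap.
module Submission where

open import Defs
open import Data.Nat using (zero; suc; _+_; _*_)
open import Data.Nat.Properties using (n<1+n; m≤n⇒∃[o]m+o≡n; +-suc)
open import Data.Nat.GeneralisedArithmetic using (fold; fold-+)
open import Data.Fin using (Fin; toℕ; splitAt; _↑ˡ_; _↑ʳ_; combine)
open import Data.Fin.Properties
  using (_≟_; any?; pigeonhole; combine-injective; splitAt-↑ˡ; splitAt-↑ʳ;
         splitAt⁻¹-↑ˡ; splitAt⁻¹-↑ʳ; ↑ˡ-injective; ↑ʳ-injective)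
open import Data.Bool using (Bool; true; false; not; _∧_; _∨_; if_then_else_)
open import Data.Bool.Properties
  using (∧-conicalˡ; ∧-conicalʳ; ∨-zeroʳ; not-¬; ¬-not) renaming (_≟_ to _≟ᵇ_)
open import Data.Product using (∃; _×_; _,_; proj₁; proj₂)
open import Data.Sum using (_⊎_; inj₁; inj₂; [_,_]′)
open import Function using (_∘_; const; mk⇔)
open import Function.Definitions using (Injective)
open import Relation.Nullary using (¬_; Dec; yes; no; does; contradiction)
open import Relation.Nullary.Decidable
  using (_×-dec_; _⊎-dec_; ¬?; decidable-stable; dec-true; dec-false; does-⇔)
open import Relation.Binary.PropositionalEquality as ≡ using (_≡_; _≢_; refl; trans; cong; cong₂; subst₂)

_==_ : Bool → Bool → Bool
x == b = if b then x else not x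

==-sound : ∀ x b → x == b ≡ true → x ≡ b
==-sound true  true  _ = refl
==-sound false false _ = refl
==-sound true  false ()
==-sound false true  ()

==-refl : ∀ x → x == x ≡ true
==-refl true  = refl
==-refl false = refl

true-== : ∀ b → b ≡ true == b
true-== true  = refl
true-== false = refl

false-== : ∀ b → not b ≡ false == b
false-== true  = refl
false-== false = refl

-- Colour classes: the edges of G that a colouring c paints b.

module _ {n} (G : Graph n) (c : Coloring n) where

  colourClass : Bool → Graph n
  adj (colourClass b) u v = adj G u v ∧ (col c u v == b)
  sym (colourClass b) u v = cong₂ _∧_ (sym G u v) (cong (_== b) (colSym c u v))
  irrefl (colourClass b) u = cong (_∧ _) (irrefl G u)

  class-edge : ∀ b {u v} → Edge (colourClass b) u v → Edge G u v × col c u v ≡ b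
  class-edge b {u} {v} e =
    ∧-conicalˡ _ _ e , ==-sound (col c u v) b (∧-conicalʳ (adj G u v) _ e)

  class-intro : ∀ {b u v} → Edge G u v → col c u v ≡ b → Edge (colourClass b) u v
  class-intro {u = u} {v} e refl = cong₂ _∧_ e (==-refl (col c u v))

  class-disjoint : ∀ b → EdgeDisjoint (colourClass b) (colourClass (not b))
  class-disjoint b u v e e' =
    not-¬ refl (trans (≡.sym (proj₂ (class-edge b e))) (proj₂ (class-edge (not b) e')))

  class-union : ∀ u v → adj (colourClass true ∪G colourClass false) u v ≡ adj G u v
  class-union u v with adj G u v | col c u v
  ... | true  | true  = refl
  ... | true  | false = refl
  ... | false | true  = refl
  ... | false | false = refl

  -- A copy of H inside one colour class is a monochromatic copy.
  class-free : ∀ {h} {H : Graph h} {b} → Good H G c → HFree H (colourClass b)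
  class-free {b = b} good (f , f-inj , f-edges) =
    good (b , f , (f-inj , λ u v e → proj₁ (class-edge b (f-edges u v e)))
                , λ u v e → proj₂ (class-edge b (f-edges u v e)))

-- Copies, connectivity and disjoint unions.

pull-back-copy : ∀ {h n m} {H : Graph h} {A : Graph n} {F : Graph m} (e : Fin n → Fin m) →
  (∀ u v → adj F (e u) (e v) ≡ adj A u v) → (f : Fin h → Fin m) → Embeds H F f →
  (∀ x → ∃ λ i → e i ≡ f x) → Copy H A
pull-back-copy {h} {n} {F = F} e e-adj f (f-inj , f-edges) preimage =
  g , (λ {x} {y} p → f-inj (trans (≡.sym (g-spec x)) (trans (cong e p) (g-spec y))))
    , λ u v uv → trans (≡.sym (e-adj (g u) (g v)))
                       (subst₂ (Edge F) (≡.sym (g-spec u)) (≡.sym (g-spec v)) (f-edges u v uv))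
  where
  g : Fin h → Fin n
  g x = proj₁ (preimage x)
  g-spec : ∀ x → e (g x) ≡ f x
  g-spec x = proj₂ (preimage x)

connected-constant : ∀ {h} {A : Set} {H : Graph h} → Connected H → (s : Fin h → A) →
  (∀ u v → Edge H u v → s u ≡ s v) → ∀ x y → s x ≡ s y
connected-constant {H = H} conn s s-edge x y = along (conn x y)
  where
  along : ∀ {x y} → Reach H x y → s x ≡ s y
  along here           = refl
  along (step uv rest) = trans (s-edge _ _ uv) (along rest)

adj⊎ : ∀ {n k} → Graph n → Graph k → Fin n ⊎ Fin k → Fin n ⊎ Fin k → Bool
adj⊎ A B (inj₁ i) (inj₁ j) = adj A i j
adj⊎ A B (inj₂ i) (inj₂ j) = adj B i j
adj⊎ A B _        _        = false

_⊕_ : ∀ {n k} → Graph n → Graph k → Graph (n + k)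
adj (_⊕_ {n} A B) x y = adj⊎ A B (splitAt n x) (splitAt n y)
sym (_⊕_ {n} A B) x y = symmetric (splitAt n x) (splitAt n y)
  where
  symmetric : ∀ s t → adj⊎ A B s t ≡ adj⊎ A B t s
  symmetric (inj₁ i) (inj₁ j) = sym A i j
  symmetric (inj₁ i) (inj₂ j) = refl
  symmetric (inj₂ i) (inj₁ j) = refl
  symmetric (inj₂ i) (inj₂ j) = sym B i j
irrefl (_⊕_ {n} A B) x = irreflexive (splitAt n x)
  where
  irreflexive : ∀ s → adj⊎ A B s s ≡ false
  irreflexive (inj₁ i) = irrefl A i
  irreflexive (inj₂ i) = irrefl B i

⊕-left : ∀ {n k} (A : Graph n) (B : Graph k) u v → adj (A ⊕ B) (u ↑ˡ k) (v ↑ˡ k) ≡ adj A u v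
⊕-left {n} {k} A B u v rewrite splitAt-↑ˡ n u k | splitAt-↑ˡ n v k = refl

⊕-right : ∀ {n k} (A : Graph n) (B : Graph k) u v → adj (A ⊕ B) (n ↑ʳ u) (n ↑ʳ v) ≡ adj B u v
⊕-right {n} {k} A B u v rewrite splitAt-↑ʳ n k u | splitAt-↑ʳ n k v = refl

⊕-disjoint : ∀ {n k} {A A' : Graph n} {B B' : Graph k} →
  EdgeDisjoint A A' → EdgeDisjoint B B' → EdgeDisjoint (A ⊕ B) (A' ⊕ B')
⊕-disjoint {n} {A = A} {A'} {B} {B'} dA dB x y = disjoint (splitAt n x) (splitAt n y)
  where
  disjoint : ∀ s t → adj⊎ A B s t ≡ true → ¬ adj⊎ A' B' s t ≡ true
  disjoint (inj₁ i) (inj₁ j) = dA i j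
  disjoint (inj₂ i) (inj₂ j) = dB i j
  disjoint (inj₁ i) (inj₂ j) ()
  disjoint (inj₂ i) (inj₁ j) ()

isLeft : ∀ {n k} → Fin n ⊎ Fin k → Bool
isLeft = [ const true , const false ]′

onLeft : ∀ n {k} → Fin (n + k) → Bool
onLeft n x = isLeft (splitAt n x)

⊕-edge-side : ∀ {n k} (A : Graph n) (B : Graph k) x y → Edge (A ⊕ B) x y → onLeft n x ≡ onLeft n y
⊕-edge-side {n} A B x y = same-side (splitAt n x) (splitAt n y)
  where
  same-side : ∀ s t → adj⊎ A B s t ≡ true → isLeft s ≡ isLeft t
  same-side (inj₁ i) (inj₁ j) _ = refl
  same-side (inj₂ i) (inj₂ j) _ = refl
  same-side (inj₁ i) (inj₂ j) ()
  same-side (inj₂ i) (inj₁ j) ()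

left-preimage : ∀ n {k} (x : Fin (n + k)) → onLeft n x ≡ true → ∃ λ i → i ↑ˡ k ≡ x
left-preimage n x on-left with splitAt n x in eq
... | inj₁ i = i , splitAt⁻¹-↑ˡ eq

right-preimage : ∀ n {k} (x : Fin (n + k)) → onLeft n x ≡ false → ∃ λ i → n ↑ʳ i ≡ x
right-preimage n x on-right with splitAt n x in eq
... | inj₂ i = i , splitAt⁻¹-↑ʳ eq

copy-one-side : ∀ {h n k} {H : Graph h} (A : Graph n) (B : Graph k) → Connected H →
  (f : Fin h → Fin (n + k)) → Embeds H (A ⊕ B) f → ∀ x y → onLeft n (f x) ≡ onLeft n (f y)
copy-one-side {n = n} A B conn f (_ , f-edges) =
  connected-constant conn (onLeft n ∘ f) (λ u v uv → ⊕-edge-side A B _ _ (f-edges u v uv))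

-- Hence a connected (nonempty) H lies in A ⊕ B only if it lies in A or in B.
⊕-free : ∀ {h n k} {H : Graph h} {A : Graph n} {B : Graph k} → Connected H → Fin h →
  HFree H A → HFree H B → HFree H (A ⊕ B)
⊕-free {n = n} {H = H} {A} {B} conn a freeA freeB (f , embeds) with onLeft n (f a) in side-a
... | true  = freeA (pull-back-copy {H = H} {A = A} {F = A ⊕ B} (_↑ˡ _) (⊕-left A B) f embeds
                λ x → left-preimage n (f x) (trans (copy-one-side A B conn f embeds x a) side-a))
... | false = freeB (pull-back-copy {H = H} {A = B} {F = A ⊕ B} (n ↑ʳ_) (⊕-right A B) f embeds
                λ x → right-preimage n (f x) (trans (copy-one-side A B conn f embeds x a) side-a))

-- Iterating an injective self-map of a finite set (g^k x is `fold x g k`).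

module _ {h} {g : Fin h → Fin h} (g-inj : Injective _≡_ _≡_ g) where

  fold-injective : ∀ k {x y} → fold x g k ≡ fold y g k → x ≡ y
  fold-injective zero    p = p
  fold-injective (suc k) p = fold-injective k (g-inj p)

  returns-from-repeat : ∀ {i j} k → suc i + k ≡ j → ∀ z → fold z g i ≡ fold z g j →
    g (fold z g k) ≡ z
  returns-from-repeat {i} k refl z repeat = ≡.sym (fold-injective i (begin
    fold z g i                   ≡⟨ repeat ⟩
    fold z g (suc i + k)         ≡⟨ cong (fold z g) (≡.sym (+-suc i k)) ⟩
    fold z g (i + suc k)         ≡⟨ fold-+ z g i ⟩
    fold (g (fold z g k)) g i    ∎))
    where open ≡.≡-Reasoning

  -- Pigeonhole on the h * h pairs (g^t x , g^t y), t ≤ h * h: some power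
  -- g^(k+1) fixes x and y simultaneously.
  simultaneous-return : ∀ x y → ∃ λ k → g (fold x g k) ≡ x × g (fold y g k) ≡ y
  simultaneous-return x y
    with i , j , i<j , same ← pigeonhole (n<1+n (h * h))
                                 (λ t → combine (fold x g (toℕ t)) (fold y g (toℕ t)))
    with k , i+1+k≡j ← m≤n⇒∃[o]m+o≡n i<j
    with x-repeats , y-repeats ← combine-injective _ _ _ _ same
    = k , returns-from-repeat k i+1+k≡j x x-repeats , returns-from-repeat k i+1+k≡j y y-repeats

-- H has no copy in a spanning subgraph K that misses an edge ab of H: an
-- injective homomorphism g : H → K ⊆ H maps g^k(ab), an edge of H, onto ab.
subgraph-copy-keeps-edges : ∀ {h} {H K : Graph h} → (∀ u v → Edge K u v → Edge H u v) →
  Copy H K → ∀ a b → Edge H a b → Edge K a b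
subgraph-copy-keeps-edges {H = H} {K} K⊆H (g , g-inj , g-edges) a b ab
  with k , g-fixes-a , g-fixes-b ← simultaneous-return g-inj a b
  = subst₂ (Edge K) g-fixes-a g-fixes-b (g-edges _ _ (iterate-edge k))
  where
  iterate-edge : ∀ k → Edge H (fold a g k) (fold b g k)
  iterate-edge zero    = ab
  iterate-edge (suc k) = K⊆H _ _ (g-edges _ _ (iterate-edge k))

-- Unordered pairs, and splitting H into H − ab and the single edge ab.

SamePair : ∀ {h} → Fin h → Fin h → Fin h → Fin h → Set
SamePair a b x y = (x ≡ a × y ≡ b) ⊎ (x ≡ b × y ≡ a)

samePair? : ∀ {h} (a b x y : Fin h) → Dec (SamePair a b x y)
samePair? a b x y = (x ≟ a ×-dec y ≟ b) ⊎-dec (x ≟ b ×-dec y ≟ a)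

samePair-swap : ∀ {h} {a b x y : Fin h} → SamePair a b x y → SamePair a b y x
samePair-swap (inj₁ (x≡a , y≡b)) = inj₂ (y≡b , x≡a)
samePair-swap (inj₂ (x≡b , y≡a)) = inj₁ (y≡a , x≡b)

samePair-unique : ∀ {h} {a b x y x' y' : Fin h} →
  SamePair a b x y → SamePair a b x' y' → SamePair x y x' y'
samePair-unique (inj₁ (refl , refl)) (inj₁ (refl , refl)) = inj₁ (refl , refl)
samePair-unique (inj₁ (refl , refl)) (inj₂ (refl , refl)) = inj₂ (refl , refl)
samePair-unique (inj₂ (refl , refl)) (inj₁ (refl , refl)) = inj₂ (refl , refl)
samePair-unique (inj₂ (refl , refl)) (inj₂ (refl , refl)) = inj₁ (refl , refl)

samePair-reflect : ∀ {h m} {g : Fin h → Fin m} {a b x y : Fin h} → Injective _≡_ _≡_ g →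
  SamePair (g a) (g b) (g x) (g y) → SamePair a b x y
samePair-reflect g-inj (inj₁ (p , q)) = inj₁ (g-inj p , g-inj q)
samePair-reflect g-inj (inj₂ (p , q)) = inj₂ (g-inj p , g-inj q)

does-sound : ∀ {A : Set} (A? : Dec A) → does A? ≡ true → A
does-sound (yes a) _ = a
does-sound (no _)  ()

pairColouring : ∀ {h} → Fin h → Fin h → Coloring h
col    (pairColouring a b) x y = does (samePair? a b x y)
colSym (pairColouring a b) x y =
  does-⇔ (mk⇔ samePair-swap samePair-swap) (samePair? a b x y) (samePair? a b y x)

deleteEdge singleEdge : ∀ {h} → Graph h → Fin h → Fin h → Graph h
deleteEdge H a b = colourClass H (pairColouring a b) false
singleEdge H a b = colourClass H (pairColouring a b) true

-- H − ab is H-free, since an injective copy of H in it would keep ab.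
deleteEdge-free : ∀ {h} {H : Graph h} {a b} → Edge H a b → HFree H (deleteEdge H a b)
deleteEdge-free {H = H} {a} {b} ab copy = ab-deleted ab-kept
  where
  ab-kept : Edge (deleteEdge H a b) a b
  ab-kept = subgraph-copy-keeps-edges {H = H} {K = deleteEdge H a b}
              (λ u v uv → proj₁ (class-edge H (pairColouring a b) false uv)) copy a b ab
  ab-deleted : ¬ Edge (deleteEdge H a b) a b
  ab-deleted e with () ← trans (≡.sym (dec-true (samePair? a b a b) (inj₁ (refl , refl))))
                               (proj₂ (class-edge H (pairColouring a b) false e))

singleEdge-free : ∀ {h} {H : Graph h} {a b p q r s} → Edge H p q → Edge H r s →
  ¬ SamePair p q r s → HFree H (singleEdge H a b)
singleEdge-free {H = H} {a} {b} pq rs distinct (g , g-inj , g-edges) =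
  distinct (samePair-reflect g-inj (samePair-unique (onPair pq) (onPair rs)))
  where
  onPair : ∀ {x y} → Edge H x y → SamePair a b (g x) (g y)
  onPair xy = does-sound (samePair? a b _ _)
                         (proj₂ (class-edge H (pairColouring a b) true (g-edges _ _ xy)))

-- Patterns with at most two vertices.

connected-on-pair : ∀ {h} {H : Graph h} {a b} → Connected H →
  (∀ x y → Edge H x y → SamePair a b x y) → ∀ x → x ≡ a ⊎ x ≡ b
connected-on-pair {a = a} conn onPair x with conn x a
... | here = inj₁ refl
... | step {v = y} xy _ with onPair x y xy
...   | inj₁ (x≡a , _) = inj₁ x≡a
...   | inj₂ (x≡b , _) = inj₂ x≡b

connected-edgeless : ∀ {h} {H : Graph h} → Connected H → (∀ x y → ¬ Edge H x y) → ∀ x y → x ≡ y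
connected-edgeless conn no-edge x y with conn x y
... | here          = refl
... | step {v = z} xz _ = contradiction xz (no-edge x z)

indicator-injective : ∀ {h} {a b : Fin h} → (∀ x → x ≡ a ⊎ x ≡ b) →
  Injective _≡_ _≡_ (λ x → does (x ≟ a))
indicator-injective {a = a} onPair {x} {y} same-label
  with x ≟ a | y ≟ a | onPair x | onPair y
... | yes x≡a | yes y≡a | _         | _         = trans x≡a (≡.sym y≡a)
... | no  x≢a | _       | inj₁ x≡a  | _         = contradiction x≡a x≢a
... | _       | no  y≢a | _         | inj₁ y≡a  = contradiction y≡a y≢a
... | no  _   | no  _   | inj₂ x≡b  | inj₂ y≡b  = trans x≡b (≡.sym y≡b)

-- If H injects into Bool (has at most two vertices), a colouring of G
-- without monochromatic H forces G to be edgeless: H maps into any edge uv.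
small-pattern-edgeless : ∀ {h n} {H : Graph h} {G : Graph n} {ψ : Coloring n}
  (d : Fin h → Bool) → Injective _≡_ _≡_ d → Good H G ψ → ∀ u v → ¬ Edge G u v
small-pattern-edgeless {n = n} {H} {G} {ψ} d d-inj good u v uv =
  good (col ψ u v , pick ∘ d
       , (d-inj ∘ pick-injective , λ x y xy → proj₁ (endpoints (ends-differ xy)))
       , λ x y xy → proj₂ (endpoints (ends-differ xy)))
  where
  pick : Bool → Fin n
  pick p = if p then u else v

  u≢v : u ≢ v
  u≢v refl with () ← trans (≡.sym (irrefl G u)) uv

  pick-injective : Injective _≡_ _≡_ pick
  pick-injective {true}  {true}  _ = refl
  pick-injective {false} {false} _ = refl
  pick-injective {true}  {false} u≡v = contradiction u≡v u≢v
  pick-injective {false} {true}  v≡u = contradiction (≡.sym v≡u) u≢v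

  ends-differ : ∀ {x y} → Edge H x y → d x ≢ d y
  ends-differ {x} xy same with refl ← d-inj same with () ← trans (≡.sym (irrefl H x)) xy

  endpoints : ∀ {p q} → p ≢ q → Edge G (pick p) (pick q) × col ψ (pick p) (pick q) ≡ col ψ u v
  endpoints {true}  {false} _ = uv , refl
  endpoints {false} {true}  _ = trans (sym G v u) uv , colSym ψ v u
  endpoints {true}  {true}  p≢q = contradiction refl p≢q
  endpoints {false} {false} p≢q = contradiction refl p≢q

small-pattern-BEL : ∀ {h} {H : Graph h} (d : Fin h → Bool) → Injective _≡_ _≡_ d → BEL H
small-pattern-BEL {H = H} d d-inj n G ψ good =
  n , G , (ψ , good) , (λ u → u) , ((λ p → p) , λ u v → refl) ,
  λ χ _ → inj₁ λ u v uv →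
    contradiction uv (small-pattern-edgeless {H = H} {G = G} {ψ = ψ} d d-inj good u v)

-- The gadget argument for patterns with two distinct edges ab and cd.

agree-up-to-swap : ∀ {n} {G : Graph n} (φ ψ : Fin n → Fin n → Bool) β →
  (∀ u v → Edge G u v → φ u v ≡ ψ u v == β) →
  (∀ u v → Edge G u v → φ u v ≡ ψ u v) ⊎ (∀ u v → Edge G u v → φ u v ≡ not (ψ u v))
agree-up-to-swap φ ψ true  agree = inj₁ agree
agree-up-to-swap φ ψ false agree = inj₂ agree

ConstantOn : ∀ {n m} → Coloring m → (Fin n → Fin m) → Graph n → Set
ConstantOn χ f K = ∀ u v u' v' → Edge K u v → Edge K u' v' → col χ (f u) (f v) ≡ col χ (f u') (f v')

module TwoEdges {h} (H : Graph h) (conn : Connected H) {a b c d : Fin h}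
                (ab : Edge H a b) (cd : Edge H c d) (distinct : ¬ SamePair a b c d) where

  ab-single : Edge (singleEdge H a b) a b
  ab-single = class-intro H (pairColouring a b) ab (dec-true (samePair? a b a b) (inj₁ (refl , refl)))

  cd-deleted : Edge (deleteEdge H a b) c d
  cd-deleted = class-intro H (pairColouring a b) cd (dec-false (samePair? a b c d) distinct)

  module _ {n} (G : Graph n) (ψ : Coloring n) where

    red blue : Graph n
    red  = colourClass G ψ true
    blue = colourClass G ψ false

    G₀ G₁ : Graph (n + h)
    G₀ = red  ⊕ deleteEdge H a b
    G₁ = blue ⊕ singleEdge H a b

    left : Fin n → Fin (n + h)
    left u = u ↑ˡ h

    right : Fin h → Fin (n + h)
    right x = n ↑ʳ x

    gadget-disjoint : EdgeDisjoint G₀ G₁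
    gadget-disjoint = ⊕-disjoint (class-disjoint G ψ true) (class-disjoint H (pairColouring a b) false)

    G₀-free : Good H G ψ → HFree H G₀
    G₀-free good = ⊕-free conn a
      (class-free G ψ {H = H} {b = true} good) (deleteEdge-free {H = H} ab)

    G₁-free : Good H G ψ → HFree H G₁
    G₁-free good = ⊕-free conn a
      (class-free G ψ {H = H} {b = false} good) (singleEdge-free {H = H} ab cd distinct)

    left-adj : ∀ u v → adj (G₀ ∪G G₁) (left u) (left v) ≡ adj G u v
    left-adj u v = trans (cong₂ _∨_ (⊕-left _ _ u v) (⊕-left _ _ u v)) (class-union G ψ u v)

    red-edge : ∀ {u v} → Edge G u v → col ψ u v ≡ true → Edge G₀ (left u) (left v)
    red-edge {u} {v} uv red-uv = trans (⊕-left red (deleteEdge H a b) u v) (class-intro G ψ uv red-uv)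

    blue-edge : ∀ {u v} → Edge G u v → col ψ u v ≡ false → Edge G₁ (left u) (left v)
    blue-edge {u} {v} uv blue-uv = trans (⊕-left blue (singleEdge H a b) u v) (class-intro G ψ uv blue-uv)

    cd₀ : Edge G₀ (right c) (right d)
    cd₀ = trans (⊕-right red _ c d) cd-deleted

    ab₁ : Edge G₁ (right a) (right b)
    ab₁ = trans (⊕-right blue _ a b) ab-single

    H-edge-placed : ∀ {x y} → Edge H x y →
      Edge G₀ (right x) (right y) ⊎ Edge G₁ (right x) (right y)
    H-edge-placed {x} {y} xy with col (pairColouring a b) x y in colour
    ... | false = inj₁ (trans (⊕-right red (deleteEdge H a b) x y)
                              (class-intro H (pairColouring a b) xy colour))
    ... | true  = inj₂ (trans (⊕-right blue (singleEdge H a b) x y)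
                              (class-intro H (pairColouring a b) xy colour))

    module Forced {m} {F : Graph m} {f : Fin (n + h) → Fin m} (f-inj : Injective _≡_ _≡_ f)
      (f-adj : ∀ x y → adj F (f x) (f y) ≡ adj (G₀ ∪G G₁) x y)
      (χ : Coloring m) (χ-good : Good H F χ)
      (same₀ : ConstantOn χ f G₀) (same₁ : ConstantOn χ f G₁)
      where

      β γ : Bool
      β = col χ (f (right c)) (f (right d))
      γ = col χ (f (right a)) (f (right b))

      G₀-edge : ∀ {x y} → Edge G₀ x y → Edge F (f x) (f y)
      G₀-edge {x} {y} e = trans (f-adj x y) (cong (_∨ adj G₁ x y) e)

      G₁-edge : ∀ {x y} → Edge G₁ x y → Edge F (f x) (f y)
      G₁-edge {x} {y} e = trans (f-adj x y) (trans (cong (adj G₀ x y ∨_) e) (∨-zeroʳ (adj G₀ x y)))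

      -- Otherwise the image of the copy of H on the right would be monochromatic.
      γ≢β : γ ≢ β
      γ≢β γ≡β = χ-good (β , f ∘ right , (↑ʳ-injective n _ _ ∘ f-inj , image-edge) , image-colour)
        where
        image-edge : ∀ x y → Edge H x y → Edge F (f (right x)) (f (right y))
        image-edge x y xy with H-edge-placed xy
        ... | inj₁ e₀ = G₀-edge e₀
        ... | inj₂ e₁ = G₁-edge e₁
        image-colour : ∀ x y → Edge H x y → col χ (f (right x)) (f (right y)) ≡ β
        image-colour x y xy with H-edge-placed xy
        ... | inj₁ e₀ = same₀ _ _ _ _ e₀ cd₀
        ... | inj₂ e₁ = trans (same₁ _ _ _ _ e₁ ab₁) γ≡β

      agreement : ∀ u v → Edge G u v → col χ (f (left u)) (f (left v)) ≡ col ψ u v == β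
      agreement u v uv with col ψ u v in colour
      ... | true  = trans (same₀ _ _ _ _ (red-edge uv colour) cd₀) (true-== β)
      ... | false = trans (same₁ _ _ _ _ (blue-edge uv colour) ab₁) (trans (¬-not γ≢β) (false-== β))

  twoEdges-BEL : WeakBEL H → BEL H
  twoEdges-BEL weak n G ψ good
    with m , F , f , (f-inj , f-adj) , (c₀ , c₀-good , _) , forcing
           ← weak (n + h) (G₀ G ψ) (G₁ G ψ) (gadget-disjoint G ψ)
                  (G₀-free G ψ good) (G₁-free G ψ good)
    = m , F , (c₀ , c₀-good) , f ∘ left G ψ
    , (↑ˡ-injective h _ _ ∘ f-inj , λ u v → trans (f-adj _ _) (left-adj G ψ u v))
    , λ χ χ-good → let open Forced G ψ {F = F} f-inj f-adj χ χ-good (proj₁ (forcing χ χ-good))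
                                                           (proj₂ (forcing χ χ-good))
                   in agree-up-to-swap {G = G} _ _ β agreement

lemma3p13 : ∀ {h} (H : Graph h) → Connected H → WeakBEL H → BEL H
lemma3p13 H conn weak with any? (λ a → any? (λ b → adj H a b ≟ᵇ true))
... | no no-edge =
  small-pattern-BEL {H = H} (const true) λ {x} {y} _ →
    connected-edgeless conn (λ x y xy → no-edge (x , y , xy)) x y
... | yes (a , b , ab)
  with any? (λ c → any? (λ d → (adj H c d ≟ᵇ true) ×-dec ¬? (samePair? a b c d)))
...   | yes (c , d , cd , distinct) = TwoEdges.twoEdges-BEL H conn ab cd distinct weak
...   | no no-other =
  small-pattern-BEL {H = H} (λ x → does (x ≟ a)) (indicator-injective (connected-on-pair conn on-pair))
  where
  on-pair : ∀ x y → Edge H x y → SamePair a b x y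
  on-pair x y xy = decidable-stable (samePair? a b x y) λ other → no-other (x , y , xy , other)
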